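{- Let $G$ be a graph isomorphic to one of $C_5$, the bull, the gem, the co-gem. Let $(A,B)$ be a partition of $V(G)$ into two sets (with $A$ possibly empty) with $|A|<|B|$, and let $H=G\oplus\mathcal{P}$ for some $\mathcal{P}$ with $(A,B)\in\mathcal{P}\subseteq\{(A,A),(B,B),(A,B)\}$. If $H$ has a connected component on exactly two vertices, then either (1) $G$ is the gem, $A$ consists of the two vertices of degree $2$, and $\mathcal{P}=\{(B,B),(A,B)\}$; or (2) $G$ is the bull, $A$ consists of the two vertices of degree $3$, and $\mathcal{P}=\{(A,A),(A,B)\}$.
   Context: All graphs are finite, simple. For $A,B\subseteq V(G)$, $G\oplus(A,B)$ is the graph on $V(G)$ in which the adjacency of distinct $u,v$ is toggled exactly when $(u,v)\in(A\times B)\cup(B\times A)$; $G\oplus\mathcal{P}$ applies all flips in $\mathcal{P}$. $C_5$ is the 5-cycle; with $abcd$ an induced path and a fifth vertex $v$: the bull has $v$ adjacent exactly to $b,c$; the gem has $v$ adjacent to all of $a,b,c,d$; the co-gem has $v$ isolated. -}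

module Defs where

open import Data.Nat using (ℕ; zero; suc)
open import Data.Bool using (Bool; true; false; _∧_; _∨_; _xor_; not; if_then_else_; T)
import Data.Bool.Properties as BoolP
open import Data.Fin using (Fin; zero; suc; _≟_)
open import Data.Fin.Properties using (all?)
open import Data.Fin.Subset using (Subset; _∈_; ∣_∣)
open import Data.Vec using (tabulate; lookup)
open import Data.List using (List; []; _∷_)
open import Data.Bool.ListAction using (any)
open import Data.Product using (_×_; _,_; Σ; ∃)
open import Data.Sum using (_⊎_)
open import Function.Bundles using (_↔_; Inverse)
open import Relation.Binary.PropositionalEquality using (_≡_; refl)
open import Relation.Nullary using (¬_)
open import Relation.Nullary.Decidable using (toWitness; ⌊_⌋)

record Graph : Set where
  field
    n      : ℕ
    adj    : Fin n → Fin n → Bool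
    sym    : ∀ x y → adj x y ≡ adj y x
    irrefl : ∀ x → adj x x ≡ false
open Graph public

Iso : Graph → Graph → Set
Iso G H = Σ (Fin (n G) ↔ Fin (n H)) λ f →
  ∀ x y → adj G x y ≡ adj H (Inverse.to f x) (Inverse.to f y)

degree : (G : Graph) → Fin (n G) → ℕ
degree G x = ∣ tabulate (adj G x) ∣

private
  eqF : Fin 5 → Fin 5 → Bool
  eqF x y = ⌊ x ≟ y ⌋

  fromEdges : List (Fin 5 × Fin 5) → Fin 5 → Fin 5 → Bool
  fromEdges es x y = any (λ { (a , b) → (eqF a x ∧ eqF b y) ∨ (eqF a y ∧ eqF b x) }) es

  mk5 : (es : List (Fin 5 × Fin 5)) →
        T ⌊ all? (λ x → all? (λ y → fromEdges es x y BoolP.≟ fromEdges es y x)) ⌋ →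
        T ⌊ all? (λ x → fromEdges es x x BoolP.≟ false) ⌋ → Graph
  mk5 es s i = record
    { n = 5 ; adj = fromEdges es
    ; sym = toWitness s
    ; irrefl = toWitness i }

  v0 v1 v2 v3 v4 : Fin 5
  v0 = zero
  v1 = suc zero
  v2 = suc (suc zero)
  v3 = suc (suc (suc zero))
  v4 = suc (suc (suc (suc zero)))

-- Vertices 0,1,2,3 form the induced path abcd; vertex 4 is the fifth vertex v.
C5 bull gem cogem : Graph
C5    = mk5 ((v0 , v1) ∷ (v1 , v2) ∷ (v2 , v3) ∷ (v3 , v4) ∷ (v4 , v0) ∷ []) _ _
bull  = mk5 ((v0 , v1) ∷ (v1 , v2) ∷ (v2 , v3) ∷ (v4 , v1) ∷ (v4 , v2) ∷ []) _ _
gem   = mk5 ((v0 , v1) ∷ (v1 , v2) ∷ (v2 , v3) ∷ (v4 , v0) ∷ (v4 , v1) ∷ (v4 , v2) ∷ (v4 , v3) ∷ []) _ _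
cogem = mk5 ((v0 , v1) ∷ (v1 , v2) ∷ (v2 , v3) ∷ []) _ _

inA : ∀ {m} → Subset m → Fin m → Bool
inA A x = lookup A x

-- G ⊕ P where (A,B) with B = complement of A, and
-- P = {(A,A) if aa} ∪ {(B,B) if bb} ∪ {(A,B)}  (the flip (A,B) is always present).
-- The adjacency of distinct u,v is toggled once for each flip in P whose
-- (X×Y)∪(Y×X) contains (u,v).
flipGraph : (G : Graph) → Subset (n G) → (aa bb : Bool) → Fin (n G) → Fin (n G) → Bool
flipGraph G A aa bb u v =
  if ⌊ u ≟ v ⌋ then false else
    (adj G u v
      xor (aa ∧ inA A u ∧ inA A v)
      xor (bb ∧ not (inA A u) ∧ not (inA A v))
      xor (inA A u xor inA A v))

data Reach {m : ℕ} (E : Fin m → Fin m → Bool) : Fin m → Fin m → Set where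
  here : ∀ {x} → Reach E x x
  step : ∀ {x y z} → E x y ≡ true → Reach E y z → Reach E x z

HasComponentOfSize2 : {m : ℕ} → (Fin m → Fin m → Bool) → Set
HasComponentOfSize2 {m} E =
  Σ (Fin m) λ u → Σ (Fin m) λ v → (¬ u ≡ v) ×
    (∀ w → (Reach E u w → (w ≡ u ⊎ w ≡ v)) × ((w ≡ u ⊎ w ≡ v) → Reach E u w))

-- A component of size two of H is an edge uv of H such that u and v have no other neighbours.
-- Flips commute with graph isomorphisms, which preserve degrees and part sizes, so it suffices
-- to treat the four graphs on Fin 5 themselves; there the claim is a finite check over the
-- 32 subsets A, the four choices of flips and the 25 candidate edges uv.
module Submission where

open import Defs
open import Data.Nat using (_<_)
open import Data.Bool using (Bool; true; false)
open import Data.Fin.Subset using (Subset; _∈_; ∁; ∣_∣)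
open import Data.Product using (_×_)
open import Data.Sum using (_⊎_)
open import Function.Bundles using (_⇔_)
open import Relation.Binary.PropositionalEquality using (_≡_)

open import Data.Nat using (ℕ; zero; suc; _<?_; _≟_)
open import Data.Nat.Properties using (+-0-commutativeMonoid)
open import Data.Bool using (if_then_else_; not)
import Data.Bool.Properties as Bool
open import Data.Fin using (Fin; zero; suc)
import Data.Fin as Fin
open import Data.Fin.Properties using (all?)
open import Data.Fin.Subset.Properties using (_∈?_)
open import Data.Vec using ([]; _∷_; lookup; tabulate)
open import Data.Vec.Properties
  using (lookup∘tabulate; tabulate∘lookup; tabulate-cong; tabulate-∘; lookup-map; []=⇒lookup; lookup⇒[]=)
open import Data.Product using (∃₂; _,_; proj₁; proj₂; uncurry)
open import Data.Sum using (inj₁; inj₂)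
import Data.Sum as ⊎
open import Data.Empty using (⊥; ⊥-elim)
open import Data.Unit using (tt)
open import Function using (_∘_)
open import Function.Bundles using (_↔_; Inverse; Injection; Equivalence; mk⇔)
open import Function.Properties.Inverse using (↔⇒↣)
import Function.Properties.Equivalence as ⇔
open import Relation.Binary.PropositionalEquality using (refl; trans; cong; subst₂; module ≡-Reasoning)
import Relation.Binary.PropositionalEquality as ≡
open import Relation.Nullary using (Dec; yes; no; contradiction)
open import Relation.Nullary.Decidable using (map′; _×-dec_; _⊎-dec_; _→-dec_; toWitness)
open import Algebra.Properties.CommutativeMonoid.Sum +-0-commutativeMonoid using (sum; sum-permute)

private
  variable
    m k : ℕ

_⇔-dec_ : {P Q : Set} → Dec P → Dec Q → Dec (P ⇔ Q)
p? ⇔-dec q? =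
  map′ (uncurry mk⇔) (λ e → Equivalence.to e , Equivalence.from e) ((p? →-dec q?) ×-dec (q? →-dec p?))

allBool? : {P : Bool → Set} → (∀ b → Dec (P b)) → Dec (∀ b → P b)
allBool? P? =
  map′ (λ { (t , f) true → t ; (t , f) false → f }) (λ h → h true , h false) (P? true ×-dec P? false)

allSubset? : {P : Subset m → Set} → (∀ A → Dec (P A)) → Dec (∀ A → P A)
allSubset? {zero}  P? = map′ (λ { p [] → p }) (λ h → h []) (P? [])
allSubset? {suc m} P? =
  map′ (λ { (i , o) (true ∷ A) → i A ; (i , o) (false ∷ A) → o A })
       (λ h → h ∘ (true ∷_) , h ∘ (false ∷_))
       (allSubset? (P? ∘ (true ∷_)) ×-dec allSubset? (P? ∘ (false ∷_)))

∣tabulate∣≡sum : (p : Fin m → Bool) → ∣ tabulate p ∣ ≡ sum (λ i → if p i then 1 else 0)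
∣tabulate∣≡sum {zero}  p = refl
∣tabulate∣≡sum {suc m} p with p zero
... | true  = cong suc (∣tabulate∣≡sum (p ∘ suc))
... | false = ∣tabulate∣≡sum (p ∘ suc)

∣tabulate∘↔∣ : (σ : Fin m ↔ Fin k) (p : Fin k → Bool) → ∣ tabulate (p ∘ Inverse.to σ) ∣ ≡ ∣ tabulate p ∣
∣tabulate∘↔∣ σ p = begin
  ∣ tabulate (p ∘ Inverse.to σ) ∣                   ≡⟨ ∣tabulate∣≡sum (p ∘ Inverse.to σ) ⟩
  sum (λ i → if p (Inverse.to σ i) then 1 else 0) ≡⟨ ≡.sym (sum-permute _ σ) ⟩
  sum (λ j → if p j then 1 else 0)                ≡⟨ ≡.sym (∣tabulate∣≡sum p) ⟩
  ∣ tabulate p ∣                                    ∎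
  where open ≡-Reasoning

IsolatedEdge : (Fin m → Fin m → Bool) → Fin m → Fin m → Set
IsolatedEdge E u v = E u v ≡ true × (∀ w → E u w ≡ true ⊎ E v w ≡ true → w ≡ u ⊎ w ≡ v)

isolatedEdge? : (E : Fin m → Fin m → Bool) (u v : Fin m) → Dec (IsolatedEdge E u v)
isolatedEdge? E u v =
  (E u v Bool.≟ true) ×-dec
  all? (λ w → ((E u w Bool.≟ true) ⊎-dec (E v w Bool.≟ true)) →-dec ((w Fin.≟ u) ⊎-dec (w Fin.≟ v)))

componentOfSize2⇒isolatedEdge : {E : Fin m → Fin m → Bool} → (∀ x → E x x ≡ false) →
  HasComponentOfSize2 E → ∃₂ (IsolatedEdge E)
componentOfSize2⇒isolatedEdge {E = E} irrefl (u , v , u≢v , component) = u , v , Euv , closed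
  where
  inComponent : ∀ {w} → Reach E u w → w ≡ u ⊎ w ≡ v
  inComponent = proj₁ (component _)

  Euv : E u v ≡ true
  Euv with proj₂ (component v) (inj₂ refl)
  ... | here = contradiction refl u≢v
  ... | step {y = y} Euy _ with inComponent (step Euy here)
  ...   | inj₁ refl = contradiction (trans (≡.sym Euy) (irrefl u)) λ ()
  ...   | inj₂ refl = Euy

  closed : ∀ w → E u w ≡ true ⊎ E v w ≡ true → w ≡ u ⊎ w ≡ v
  closed w (inj₁ Euw) = inComponent (step Euw here)
  closed w (inj₂ Evw) = inComponent (step Euv (step Evw here))

isolatedEdge-transport : (σ : Fin m ↔ Fin k) {E : Fin m → Fin m → Bool} {F : Fin k → Fin k → Bool} →
  (∀ x y → E x y ≡ F (Inverse.to σ x) (Inverse.to σ y)) →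
  ∀ {u v} → IsolatedEdge E u v → IsolatedEdge F (Inverse.to σ u) (Inverse.to σ v)
isolatedEdge-transport σ {E} {F} E≡F {u} {v} (Euv , closed) = trans (≡.sym (E≡F u v)) Euv , closed′
  where
  open Inverse σ

  F≡E : ∀ x w → F (to x) w ≡ E x (from w)
  F≡E x w = trans (cong (F (to x)) (≡.sym (strictlyInverseˡ w))) (≡.sym (E≡F x (from w)))

  from≡⇒≡to : ∀ {x w} → from w ≡ x → w ≡ to x
  from≡⇒≡to refl = ≡.sym (strictlyInverseˡ _)

  closed′ : ∀ w → F (to u) w ≡ true ⊎ F (to v) w ≡ true → w ≡ to u ⊎ w ≡ to v
  closed′ w adjacent =
    ⊎.map from≡⇒≡to from≡⇒≡to
      (closed (from w) (⊎.map (trans (≡.sym (F≡E u w))) (trans (≡.sym (F≡E v w))) adjacent))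

flipGraph-irrefl : (G : Graph) (A : Subset (n G)) (aa bb : Bool) → ∀ x → flipGraph G A aa bb x x ≡ false
flipGraph-irrefl G A aa bb x with x Fin.≟ x
... | yes _  = refl
... | no x≢x = contradiction refl x≢x

IsolatedEdgeForces : (K : Graph) → (Subset (n K) → Bool → Bool → Set) → Set
IsolatedEdgeForces K P =
  ∀ A aa bb u v → ∣ A ∣ < ∣ ∁ A ∣ → IsolatedEdge (flipGraph K A aa bb) u v → P A aa bb

isolatedEdgeForces? : (K : Graph) {P : Subset (n K) → Bool → Bool → Set} →
  (∀ A aa bb → Dec (P A aa bb)) → Dec (IsolatedEdgeForces K P)
isolatedEdgeForces? K P? =
  allSubset? λ A → allBool? λ aa → allBool? λ bb → all? λ u → all? λ v →
    (∣ A ∣ <? ∣ ∁ A ∣) →-dec (isolatedEdge? (flipGraph K A aa bb) u v →-dec P? A aa bb)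

DegreeSplit : (G : Graph) → ℕ → Bool → Bool → Subset (n G) → Bool → Bool → Set
DegreeSplit G d a₀ b₀ A aa bb = (∀ x → x ∈ A ⇔ degree G x ≡ d) × aa ≡ a₀ × bb ≡ b₀

degreeSplit? : (G : Graph) (d : ℕ) (a₀ b₀ : Bool) → ∀ A aa bb → Dec (DegreeSplit G d a₀ b₀ A aa bb)
degreeSplit? G d a₀ b₀ A aa bb =
  all? (λ x → (x ∈? A) ⇔-dec (degree G x ≟ d)) ×-dec (aa Bool.≟ a₀) ×-dec (bb Bool.≟ b₀)

module Transport (G K : Graph) (σ : Iso G K) where
  open Inverse (proj₁ σ)

  image : Subset (n G) → Subset (n K)
  image A = tabulate (lookup A ∘ from)

  lookup-image : ∀ A x → lookup (image A) (to x) ≡ lookup A x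
  lookup-image A x = trans (lookup∘tabulate _ (to x)) (cong (lookup A) (strictlyInverseʳ x))

  ∈⇔∈image : ∀ A x → x ∈ A ⇔ to x ∈ image A
  ∈⇔∈image A x = mk⇔
    (λ x∈A → lookup⇒[]= (to x) (image A) (trans (lookup-image A x) ([]=⇒lookup x∈A)))
    (λ tx∈A′ → lookup⇒[]= x A (trans (≡.sym (lookup-image A x)) ([]=⇒lookup tx∈A′)))

  ∣image∣ : ∀ A → ∣ image A ∣ ≡ ∣ A ∣
  ∣image∣ A = begin
    ∣ tabulate (lookup A ∘ from) ∣        ≡⟨ ≡.sym (∣tabulate∘↔∣ (proj₁ σ) _) ⟩
    ∣ tabulate (lookup A ∘ from ∘ to) ∣   ≡⟨ cong ∣_∣ (tabulate-cong (cong (lookup A) ∘ strictlyInverseʳ)) ⟩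
    ∣ tabulate (lookup A) ∣               ≡⟨ cong ∣_∣ (tabulate∘lookup A) ⟩
    ∣ A ∣                                 ∎
    where open ≡-Reasoning

  ∁-image : ∀ A → ∁ (image A) ≡ image (∁ A)
  ∁-image A = trans (≡.sym (tabulate-∘ not (lookup A ∘ from)))
                    (tabulate-cong (λ y → ≡.sym (lookup-map (from y) not A)))

  ∣∁image∣ : ∀ A → ∣ ∁ (image A) ∣ ≡ ∣ ∁ A ∣
  ∣∁image∣ A = trans (cong ∣_∣ (∁-image A)) (∣image∣ (∁ A))

  degree-to : ∀ x → degree K (to x) ≡ degree G x
  degree-to x = trans (≡.sym (∣tabulate∘↔∣ (proj₁ σ) (adj K (to x))))
                      (cong ∣_∣ (tabulate-cong (≡.sym ∘ proj₂ σ x)))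

  flipGraph-to : ∀ A aa bb x y → flipGraph G A aa bb x y ≡ flipGraph K (image A) aa bb (to x) (to y)
  flipGraph-to A aa bb x y with x Fin.≟ y | to x Fin.≟ to y
  ... | yes _    | yes _     = refl
  ... | yes refl | no tx≢tx  = contradiction refl tx≢tx
  ... | no x≢y   | yes tx≡ty = contradiction (Injection.injective (↔⇒↣ (proj₁ σ)) tx≡ty) x≢y
  ... | no _     | no _
    rewrite proj₂ σ x y | lookup-image A x | lookup-image A y = refl

  isolatedEdgeForces-pullback : ∀ {P} → IsolatedEdgeForces K P →
    ∀ A → ∣ A ∣ < ∣ ∁ A ∣ → ∀ aa bb → HasComponentOfSize2 (flipGraph G A aa bb) → P (image A) aa bb
  isolatedEdgeForces-pullback forces A |A|<|∁A| aa bb component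
    with componentOfSize2⇒isolatedEdge (flipGraph-irrefl G A aa bb) component
  ... | u , v , isolated =
    forces (image A) aa bb (to u) (to v)
      (subst₂ _<_ (≡.sym (∣image∣ A)) (≡.sym (∣∁image∣ A)) |A|<|∁A|)
      (isolatedEdge-transport (proj₁ σ) {F = flipGraph K (image A) aa bb} (flipGraph-to A aa bb) isolated)

  degreeSplit-pullback : ∀ {d a₀ b₀ A aa bb} → DegreeSplit K d a₀ b₀ (image A) aa bb → DegreeSplit G d a₀ b₀ A aa bb
  degreeSplit-pullback {d} {A = A} (split , aa≡a₀ , bb≡b₀) = split′ , aa≡a₀ , bb≡b₀
    where
    split′ : ∀ x → x ∈ A ⇔ degree G x ≡ d
    split′ x = ⇔.trans (∈⇔∈image A x) (⇔.trans (split (to x))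
                 (mk⇔ (trans (≡.sym (degree-to x))) (trans (degree-to x))))

C5-isolatedEdge : IsolatedEdgeForces C5 (λ _ _ _ → ⊥)
C5-isolatedEdge = toWitness {a? = isolatedEdgeForces? C5 (λ _ _ _ → no λ ())} tt

bull-isolatedEdge : IsolatedEdgeForces bull (DegreeSplit bull 3 true false)
bull-isolatedEdge = toWitness {a? = isolatedEdgeForces? bull (degreeSplit? bull 3 true false)} tt

gem-isolatedEdge : IsolatedEdgeForces gem (DegreeSplit gem 2 false true)
gem-isolatedEdge = toWitness {a? = isolatedEdgeForces? gem (degreeSplit? gem 2 false true)} tt

cogem-isolatedEdge : IsolatedEdgeForces cogem (λ _ _ _ → ⊥)
cogem-isolatedEdge = toWitness {a? = isolatedEdgeForces? cogem (λ _ _ _ → no λ ())} tt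

lemma3p5 : (G : Graph) →
    (Iso G C5 ⊎ Iso G bull ⊎ Iso G gem ⊎ Iso G cogem) →
    (A : Subset (n G)) → ∣ A ∣ < ∣ ∁ A ∣ →
    (aa bb : Bool) →
    HasComponentOfSize2 (flipGraph G A aa bb) →
    (Iso G gem × (∀ x → (x ∈ A) ⇔ (degree G x ≡ 2)) × aa ≡ false × bb ≡ true)
    ⊎ (Iso G bull × (∀ x → (x ∈ A) ⇔ (degree G x ≡ 3)) × aa ≡ true × bb ≡ false)
lemma3p5 G (inj₁ σ) A |A|<|∁A| aa bb component =
  ⊥-elim (Transport.isolatedEdgeForces-pullback G C5 σ C5-isolatedEdge A |A|<|∁A| aa bb component)
lemma3p5 G (inj₂ (inj₁ σ)) A |A|<|∁A| aa bb component =
  inj₂ (σ , Transport.degreeSplit-pullback G bull σ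
              (Transport.isolatedEdgeForces-pullback G bull σ bull-isolatedEdge A |A|<|∁A| aa bb component))
lemma3p5 G (inj₂ (inj₂ (inj₁ σ))) A |A|<|∁A| aa bb component =
  inj₁ (σ , Transport.degreeSplit-pullback G gem σ
              (Transport.isolatedEdgeForces-pullback G gem σ gem-isolatedEdge A |A|<|∁A| aa bb component))
lemma3p5 G (inj₂ (inj₂ (inj₂ σ))) A |A|<|∁A| aa bb component =
  ⊥-elim (Transport.isolatedEdgeForces-pullback G cogem σ cogem-isolatedEdge A |A|<|∁A| aa bb component)
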